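{- Every depth-$2$ circuit $F$ computing a linear operator can be transformed into an equivalent linear depth-$2$ circuit of the same degree and width at most $\mathrm{mr}(A_F)$.
   Context: A depth-$2$ circuit of width $w$ with $n$ inputs $x_1,\dots,x_n$ and $m$ outputs has $w$ arbitrary boolean functions $h_1,\dots,h_w$ of the inputs on the middle layer and $m$ output gates $g_1,\dots,g_m$, where $g_i$ is an arbitrary boolean function of the middle-layer values and of those inputs $x_j$ connected to it by a direct input-output wire; it computes $f$ if $f_i(\mathbf{x})=g_i(\mathbf{x},h_1(\mathbf{x}),\dots,h_w(\mathbf{x}))$ for all $i,\mathbf{x}$. Its degree is the maximum over output gates of the number of direct input-output wires entering that gate. A circuit is linear if all its gates compute linear (parity, possibly plus constant) functions over $GF_2$. If $F$ computes the linear operator $\mathbf{x}\mapsto M\mathbf{x}$ over $GF_2$ ($M$ an $m$-by-$n$ $(0,1)$-matrix), $A_F$ is the $(0,1,\ast)$-matrix obtained from $M$ by replacing entry $(i,j)$ by $\ast$ whenever there is a direct wire from $x_j$ to the $i$th output gate. A completion of a $(0,1,\ast)$-matrix is obtained by replacing each $\ast$ by $0$ or $1$; $\mathrm{mr}(A)$ is the minimum $GF_2$-rank of a completion of $A$. Equivalent circuits compute the same operator. -}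

module Defs where

open import Data.Nat using (ℕ; zero; suc; _+_; _⊔_; _≤_)
open import Data.Fin using (Fin; zero; suc)
open import Data.Bool using (Bool; true; false; _∧_; _xor_; if_then_else_)
open import Data.Maybe using (Maybe; just; nothing)
open import Data.Product using (Σ; ∃; _×_; _,_)
open import Relation.Binary.PropositionalEquality using (_≡_)

-- GF(2) vectors / matrices as Bool-valued functions; xor is GF(2) addition,
-- ∧ is GF(2) multiplication.

parity : (k : ℕ) → (Fin k → Bool) → Bool
parity zero    f = false
parity (suc k) f = f zero xor parity k (λ j → f (suc j))

sumℕ : (k : ℕ) → (Fin k → ℕ) → ℕ
sumℕ zero    f = 0
sumℕ (suc k) f = f zero + sumℕ k (λ j → f (suc j))

maxℕ : (k : ℕ) → (Fin k → ℕ) → ℕ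
maxℕ zero    f = 0
maxℕ (suc k) f = f zero ⊔ maxℕ k (λ j → f (suc j))

Matrix : ℕ → ℕ → Set
Matrix m n = Fin m → Fin n → Bool

_·ᵥ_ : ∀ {m n} → Matrix m n → (Fin n → Bool) → (Fin m → Bool)
(M ·ᵥ x) i = parity _ (λ j → M i j ∧ x j)

_·ₘ_ : ∀ {m r n} → Matrix m r → Matrix r n → Matrix m n
(U ·ₘ V) i j = parity _ (λ k → U i k ∧ V k j)

RankAtMost : ∀ {m n} → Matrix m n → ℕ → Set
RankAtMost {m} {n} M r =
  Σ (Matrix m r) λ U → Σ (Matrix r n) λ V → ∀ i j → M i j ≡ (U ·ₘ V) i j

IsRank : ∀ {m n} → Matrix m n → ℕ → Set
IsRank M r = RankAtMost M r × (∀ r' → RankAtMost M r' → r ≤ r')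

-- (0,1,*)-matrices: nothing = ∗
PMatrix : ℕ → ℕ → Set
PMatrix m n = Fin m → Fin n → Maybe Bool

IsCompletion : ∀ {m n} → PMatrix m n → Matrix m n → Set
IsCompletion A C = ∀ i j b → A i j ≡ just b → C i j ≡ b

IsMinRank : ∀ {m n} → PMatrix m n → ℕ → Set
IsMinRank {m} {n} A r =
  (Σ (Matrix m n) λ C → IsCompletion A C × IsRank C r)
  × (∀ (C : Matrix m n) r' → IsCompletion A C → IsRank C r' → r ≤ r')

-- Depth-2 circuit with n inputs, m outputs, width w.
-- wire i j = true iff there is a direct wire from x_j to output gate i.
-- The output gate g i sees only the inputs wired to it: it is applied to
-- the masked input (unwired inputs replaced by false), so it is a
-- function of the wired inputs and the middle layer only.
record Circuit (n m w : ℕ) : Set where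
  field
    h    : Fin w → (Fin n → Bool) → Bool
    wire : Fin m → Fin n → Bool
    g    : Fin m → (Fin n → Bool) → (Fin w → Bool) → Bool
open Circuit public

mask : ∀ {n} → (Fin n → Bool) → (Fin n → Bool) → (Fin n → Bool)
mask s x j = s j ∧ x j

gate : ∀ {n m w} → Circuit n m w → Fin m → (Fin n → Bool) → (Fin w → Bool) → Bool
gate F i x y = g F i (mask (wire F i) x) y

eval : ∀ {n m w} → Circuit n m w → (Fin n → Bool) → (Fin m → Bool)
eval F x i = gate F i x (λ k → h F k x)

Computes : ∀ {n m w} → Circuit n m w → Matrix m n → Set
Computes F M = ∀ x i → eval F x i ≡ (M ·ᵥ x) i

degree : ∀ {n m w} → Circuit n m w → ℕ
degree {n} {m} F = maxℕ m (λ i → sumℕ n (λ j → if wire F i j then 1 else 0))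

Affine : ∀ {k} → ((Fin k → Bool) → Bool) → Set
Affine {k} f = Σ Bool λ c → Σ (Fin k → Bool) λ a →
  ∀ x → f x ≡ c xor parity k (λ j → a j ∧ x j)

Affine₂ : ∀ {k l} → ((Fin k → Bool) → (Fin l → Bool) → Bool) → Set
Affine₂ {k} {l} f = Σ Bool λ c → Σ (Fin k → Bool) λ a → Σ (Fin l → Bool) λ b →
  ∀ x y → f x y ≡ (c xor parity k (λ j → a j ∧ x j)) xor parity l (λ j → b j ∧ y j)

IsLinear : ∀ {n m w} → Circuit n m w → Set
IsLinear {n} {m} {w} F = (∀ k → Affine (h F k)) × (∀ i → Affine₂ (gate F i))

A[_,_] : ∀ {n m w} → Circuit n m w → Matrix m n → PMatrix m n
A[ F , M ] i j = if wire F i j then nothing else just (M i j)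

{-# OPTIONS --safe #-}
-- Take a completion C of A_F of rank r = mr(A_F), factor it as C = U V, and
-- let the new circuit compute V x on its r middle gates. Since C agrees with M
-- off the wired positions, M - C is supported on the direct wires, so output i
-- can compute ((M - C) x)_i from its wired inputs and add (U (V x))_i = (C x)_i.
-- The wires are unchanged, hence so is the degree.
module Submission where

open import Defs
open import Data.Nat using (ℕ; zero; suc; _≤_)
open import Data.Nat.Properties using (≤-refl)
open import Data.Fin using (Fin; zero; suc)
open import Data.Bool using (Bool; true; false; _∧_; _xor_)
open import Data.Bool.Properties
  using (∧-assoc; ∧-comm; ∧-distribˡ-xor; ∧-distribʳ-xor; ∧-identityʳ; ∧-zeroʳ;
         xor-assoc; xor-identityʳ; xor-same; xor-∧-commutativeRing)
open import Data.Product using (Σ; _×_; _,_)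
open import Relation.Binary.PropositionalEquality
  using (_≡_; refl; sym; trans; cong; cong₂; module ≡-Reasoning)
open import Algebra.Bundles using (CommutativeRing)
open import Algebra.Properties.CommutativeSemigroup
  (CommutativeRing.+-commutativeSemigroup xor-∧-commutativeRing)
  using (interchange)

open ≡-Reasoning

parity-cong : ∀ k {f g : Fin k → Bool} → (∀ j → f j ≡ g j) → parity k f ≡ parity k g
parity-cong zero    f≗g = refl
parity-cong (suc k) f≗g = cong₂ _xor_ (f≗g zero) (parity-cong k (λ j → f≗g (suc j)))

parity-false : ∀ k → parity k (λ _ → false) ≡ false
parity-false zero    = refl
parity-false (suc k) = parity-false k

parity-xor : ∀ k (f g : Fin k → Bool) →
  parity k (λ j → f j xor g j) ≡ parity k f xor parity k g
parity-xor zero    f g = refl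
parity-xor (suc k) f g = begin
  (f zero xor g zero) xor parity k (λ j → f (suc j) xor g (suc j))
    ≡⟨ cong ((f zero xor g zero) xor_) (parity-xor k _ _) ⟩
  (f zero xor g zero) xor (parity k (λ j → f (suc j)) xor parity k (λ j → g (suc j)))
    ≡⟨ interchange (f zero) (g zero) _ _ ⟩
  parity (suc k) f xor parity (suc k) g ∎

∧-parity : ∀ k b (f : Fin k → Bool) → b ∧ parity k f ≡ parity k (λ j → b ∧ f j)
∧-parity zero    b f = ∧-zeroʳ b
∧-parity (suc k) b f =
  trans (∧-distribˡ-xor b (f zero) _) (cong ((b ∧ f zero) xor_) (∧-parity k b _))

parity-swap : ∀ a b (f : Fin a → Fin b → Bool) →
  parity a (λ i → parity b (f i)) ≡ parity b (λ j → parity a (λ i → f i j))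
parity-swap zero    b f = sym (parity-false b)
parity-swap (suc a) b f = begin
  parity b (f zero) xor parity a (λ i → parity b (f (suc i)))
    ≡⟨ cong (parity b (f zero) xor_) (parity-swap a b (λ i → f (suc i))) ⟩
  parity b (f zero) xor parity b (λ j → parity a (λ i → f (suc i) j))
    ≡⟨ parity-xor b (f zero) _ ⟨
  parity b (λ j → parity (suc a) (λ i → f i j)) ∎

_+ₘ_ : ∀ {m n} → Matrix m n → Matrix m n → Matrix m n
(A +ₘ B) i j = A i j xor B i j

_⊙_ : ∀ {m n} → Matrix m n → Matrix m n → Matrix m n
(A ⊙ B) i j = A i j ∧ B i j

·ᵥ-cong : ∀ {m n} {A B : Matrix m n} → (∀ i j → A i j ≡ B i j) →
  ∀ x i → (A ·ᵥ x) i ≡ (B ·ᵥ x) i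
·ᵥ-cong A≡B x i = parity-cong _ (λ j → cong (_∧ x j) (A≡B i j))

+ₘ-·ᵥ : ∀ {m n} (A B : Matrix m n) x i →
  ((A +ₘ B) ·ᵥ x) i ≡ (A ·ᵥ x) i xor (B ·ᵥ x) i
+ₘ-·ᵥ {n = n} A B x i =
  trans (parity-cong n (λ j → ∧-distribʳ-xor (x j) (A i j) (B i j)))
        (parity-xor n (λ j → A i j ∧ x j) (λ j → B i j ∧ x j))

·ₘ-·ᵥ : ∀ {m r n} (U : Matrix m r) (V : Matrix r n) x i →
  ((U ·ₘ V) ·ᵥ x) i ≡ (U ·ᵥ (V ·ᵥ x)) i
·ₘ-·ᵥ {r = r} {n} U V x i = begin
  parity n (λ j → parity r (λ k → U i k ∧ V k j) ∧ x j)
    ≡⟨ parity-cong n (λ j → trans (∧-comm _ (x j)) (∧-parity r (x j) _)) ⟩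
  parity n (λ j → parity r (λ k → x j ∧ (U i k ∧ V k j)))
    ≡⟨ parity-swap r n _ ⟨
  parity r (λ k → parity n (λ j → x j ∧ (U i k ∧ V k j)))
    ≡⟨ parity-cong r (λ k → parity-cong n (λ j → reassociate (x j) (U i k) (V k j))) ⟩
  parity r (λ k → parity n (λ j → U i k ∧ (V k j ∧ x j)))
    ≡⟨ parity-cong r (λ k → ∧-parity n (U i k) _) ⟨
  parity r (λ k → U i k ∧ parity n (λ j → V k j ∧ x j)) ∎
  where
  reassociate : ∀ a b c → a ∧ (b ∧ c) ≡ b ∧ (c ∧ a)
  reassociate a b c = trans (∧-comm a _) (∧-assoc b c a)

mask-·ᵥ : ∀ {m n} (D : Matrix m n) (s : Matrix m n) x i →
  (D ·ᵥ mask (s i) x) i ≡ ((D ⊙ s) ·ᵥ x) i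
mask-·ᵥ D s x i = parity-cong _ (λ j → sym (∧-assoc (D i j) (s i j) (x j)))

-- Off the wires C agrees with M; on them the two copies of C cancel.
completion-decomposition : ∀ {n m w} (F : Circuit n m w) (M C : Matrix m n) →
  IsCompletion A[ F , M ] C → ∀ i j → M i j ≡ (((M +ₘ C) ⊙ wire F) +ₘ C) i j
completion-decomposition F M C completes i j with wire F i j | completes i j
... | true  | _   = begin
  M i j                             ≡⟨ xor-identityʳ (M i j) ⟨
  M i j xor false                   ≡⟨ cong (M i j xor_) (xor-same (C i j)) ⟨
  M i j xor (C i j xor C i j)       ≡⟨ xor-assoc (M i j) (C i j) (C i j) ⟨
  (M i j xor C i j) xor C i j       ≡⟨ cong (_xor C i j) (∧-identityʳ (M i j xor C i j)) ⟨
  ((M i j xor C i j) ∧ true) xor C i j ∎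
... | false | C≡M =
  trans (sym (C≡M (M i j) refl)) (cong (_xor C i j) (sym (∧-zeroʳ (M i j xor C i j))))

linearCircuit : ∀ {n m r} → Matrix m n → Matrix m n → Matrix m r → Matrix r n → Circuit n m r
linearCircuit s D U V = record
  { h    = λ k x → (V ·ᵥ x) k
  ; wire = s
  ; g    = λ i x y → (D ·ᵥ x) i xor (U ·ᵥ y) i
  }

linearCircuit-isLinear : ∀ {n m r} (s D : Matrix m n) (U : Matrix m r) (V : Matrix r n) →
  IsLinear (linearCircuit s D U V)
linearCircuit-isLinear s D U V =
  (λ k → false , V k , λ x → refl) ,
  (λ i → false , (D ⊙ s) i , U i , λ x y → cong (_xor (U ·ᵥ y) i) (mask-·ᵥ D s x i))

linearCircuit-eval : ∀ {n m r} (s D : Matrix m n) (U : Matrix m r) (V : Matrix r n) x i →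
  eval (linearCircuit s D U V) x i ≡ (((D ⊙ s) +ₘ (U ·ₘ V)) ·ᵥ x) i
linearCircuit-eval s D U V x i = begin
  (D ·ᵥ mask (s i) x) i xor (U ·ᵥ (V ·ᵥ x)) i
    ≡⟨ cong₂ _xor_ (mask-·ᵥ D s x i) (sym (·ₘ-·ᵥ U V x i)) ⟩
  ((D ⊙ s) ·ᵥ x) i xor ((U ·ₘ V) ·ᵥ x) i
    ≡⟨ +ₘ-·ᵥ (D ⊙ s) (U ·ₘ V) x i ⟨
  (((D ⊙ s) +ₘ (U ·ₘ V)) ·ᵥ x) i ∎

lemma3 : ∀ {n m w} (F : Circuit n m w) (M : Matrix m n) → Computes F M →
    ∀ r → IsMinRank A[ F , M ] r →
    Σ ℕ λ w' → Σ (Circuit n m w') λ F' →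
      w' ≤ r × IsLinear F' × Computes F' M × degree F' ≡ degree F
lemma3 {n} {m} F M _ r ((C , completes , (U , V , C≡UV) , _) , _) =
  r , F' , ≤-refl , linearCircuit-isLinear (wire F) (M +ₘ C) U V , computes , refl
  where
  F' : Circuit n m r
  F' = linearCircuit (wire F) (M +ₘ C) U V
  D : Matrix m n
  D = (M +ₘ C) ⊙ wire F
  computes : Computes F' M
  computes x i = begin
    eval F' x i               ≡⟨ linearCircuit-eval (wire F) (M +ₘ C) U V x i ⟩
    ((D +ₘ (U ·ₘ V)) ·ᵥ x) i  ≡⟨ ·ᵥ-cong (λ i j → cong (D i j xor_) (C≡UV i j)) x i ⟨
    ((D +ₘ C) ·ᵥ x) i         ≡⟨ ·ᵥ-cong (completion-decomposition F M C completes) x i ⟨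
    (M ·ᵥ x) i ∎
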